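{- For every integer $n\geq 3$, the number of Fishburn permutations $\pi=\pi_1\cdots\pi_n$ of length $n$ that avoid both $321$ and $2134$ and satisfy $\pi_2=1$ equals $2n-4$.
   Context: A permutation of length $n$ is a rearrangement $\pi=\pi_1\cdots\pi_n$ of $[n]$. A permutation $\pi$ contains a classical pattern $p\in S_k$ if some subsequence of $\pi$ of length $k$ is order-isomorphic to $p$; otherwise it avoids $p$. A Fishburn permutation is a permutation $\pi$ for which there are no indices $i<j$ with $\pi_j<\pi_i<\pi_{i+1}$ and $\pi_i=\pi_j+1$. -}

module Defs where

open import Data.Nat using (ℕ; zero; suc; _<_; _≤_)
open import Data.Fin using (Fin; toℕ)
open import Data.Vec using (Vec; lookup)
open import Data.Product using (Σ; _×_; _,_)
open import Data.List using (List; length)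
open import Data.List.Membership.Propositional using (_∈_)
open import Data.List.Relation.Unary.Unique.Propositional using (Unique)
open import Relation.Binary.PropositionalEquality using (_≡_)
open import Relation.Nullary using (¬_)
open import Function.Bundles using (_⇔_)

-- A word of length n over [n] (0-based values: value v stands for v+1);
-- positions are also 0-based (position i stands for index i+1).
Word : ℕ → Set
Word n = Vec (Fin n) n

IsPerm : ∀ {n} → Word n → Set
IsPerm {n} π = ∀ (i j : Fin n) → lookup π i ≡ lookup π j → i ≡ j

_≺_ : ∀ {n} → Fin n → Fin n → Set
a ≺ b = toℕ a < toℕ b

Contains321 : ∀ {n} → Word n → Set
Contains321 {n} π = Σ (Fin n) λ i → Σ (Fin n) λ j → Σ (Fin n) λ k →
  (toℕ i < toℕ j) × (toℕ j < toℕ k) ×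
  (lookup π j ≺ lookup π i) × (lookup π k ≺ lookup π j)

Contains2134 : ∀ {n} → Word n → Set
Contains2134 {n} π = Σ (Fin n) λ i → Σ (Fin n) λ j → Σ (Fin n) λ k → Σ (Fin n) λ l →
  (toℕ i < toℕ j) × (toℕ j < toℕ k) × (toℕ k < toℕ l) ×
  (lookup π j ≺ lookup π i) × (lookup π i ≺ lookup π k) × (lookup π k ≺ lookup π l)

IsFishburn : ∀ {n} → Word n → Set
IsFishburn {n} π = ¬ (Σ (Fin n) λ i → Σ (Fin n) λ i' → Σ (Fin n) λ j →
  (toℕ i' ≡ suc (toℕ i)) × (toℕ i < toℕ j) ×
  (lookup π j ≺ lookup π i) × (lookup π i ≺ lookup π i') ×
  (toℕ (lookup π i) ≡ suc (toℕ (lookup π j))))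

Counted : ∀ {n} → Word n → Set
Counted {n} π = IsPerm π × IsFishburn π × ¬ Contains321 π × ¬ Contains2134 π ×
  (Σ (Fin n) λ p → (toℕ p ≡ 1) × (toℕ (lookup π p) ≡ 0))

HasCount : ∀ {n} → (Word n → Set) → ℕ → Set
HasCount {n} P m = Σ (List (Word n)) λ L →
  Unique L × (length L ≡ m) × (∀ π → (π ∈ L) ⇔ P π)

{-# OPTIONS --safe #-}
-- Write n = M + 3 and call an entry large when it exceeds the first entry a. With π₂ = 1,
-- avoiding 321 forces the small entries to increase, avoiding 2134 (started by π₁ π₂) forces
-- the large entries to decrease, and 321 again forces every large value other than n to be
-- the last entry. Conversely these conditions exclude 321, 2134 and even every vincular 231,
-- so the Fishburn condition comes for free. Such a permutation is determined by where its
-- large values sit, and at most one large value may be non-maximal, so a ≥ n - 2: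
-- a = n gives one permutation, a = n - 1 gives n - 2 (one for each position of n after π₂),
-- and a = n - 2 forces n - 1 to the end and gives n - 3; in total 2n - 4.
module Submission where

open import Defs
open import Data.Nat using (ℕ; zero; suc; pred; _+_; _*_; _∸_; _≤_; _<_; z≤n; s≤s; z<s; _≤?_; _<?_)
open import Data.Nat.Properties
open import Data.Nat.Induction using (<-rec)
open import Data.Fin using (Fin; toℕ; fromℕ<; punchOut)
open import Data.Fin.Properties
  using (toℕ<n; toℕ-fromℕ<; toℕ-injective; any?; punchOut-injective; <⇒notInjective)
  renaming (_≟_ to _≟ᶠ_)
open import Data.Vec using (Vec; []; _∷_; lookup; tabulate)
open import Data.Vec.Properties using (lookup∘tabulate; tabulate∘lookup; tabulate-cong)
open import Data.List as List using (List; _++_; length)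
open import Data.List.Properties using (length-++; length-tabulate)
open import Data.List.Membership.Propositional using (_∈_)
open import Data.List.Membership.Propositional.Properties
  using (∈-++⁺ˡ; ∈-++⁺ʳ; ∈-++⁻; ∈-tabulate⁺; ∈-tabulate⁻)
open import Data.List.Relation.Unary.Any using (here; there)
import Data.List.Relation.Unary.All as All
import Data.List.Relation.Unary.AllPairs as AllPairs
open import Data.List.Relation.Unary.Unique.Propositional using (Unique)
import Data.List.Relation.Unary.Unique.Propositional.Properties as Unique
open import Data.Product using (Σ; ∃-syntax; _×_; _,_)
open import Data.Sum using (_⊎_; inj₁; inj₂)
open import Data.Empty using (⊥; ⊥-elim)
open import Function using (_∘_; id)
open import Function.Bundles using (_⇔_; mk⇔)
open import Function.Definitions using (Injective)
open import Relation.Nullary using (¬_; yes; no; contradiction)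
open import Relation.Binary.PropositionalEquality
open import Relation.Binary.Definitions using (tri<; tri≈; tri>)

InjectiveOn : ℕ → (ℕ → ℕ) → Set
InjectiveOn N f = ∀ {x y} → x < N → y < N → f x ≡ f y → x ≡ y

MapsBelow : ℕ → (ℕ → ℕ) → Set
MapsBelow N f = ∀ {x} → x < N → f x < N

SurjectiveOn : ℕ → (ℕ → ℕ) → Set
SurjectiveOn N f = ∀ {v} → v < N → ∃[ x ] x < N × f x ≡ v

IncreasingBelow : ℕ → ℕ → (ℕ → ℕ) → Set
IncreasingBelow N a f = ∀ {x y} → x < y → y < N → f x < a → f y < a → f x < f y

_≗[_]_ : (ℕ → ℕ) → ℕ → (ℕ → ℕ) → Set
f ≗[ N ] g = ∀ {x} → x < N → f x ≡ g x

injective⇒surjective-Fin : ∀ {n} (h : Fin n → Fin n) → Injective _≡_ _≡_ h → ∀ y → ∃[ i ] h i ≡ y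
injective⇒surjective-Fin {suc m} h h-inj y with any? (λ i → h i ≟ᶠ y)
... | yes hit  = hit
... | no  miss = contradiction (λ {i} {j} → punchOut-injective′ {i} {j}) (<⇒notInjective (n<1+n m))
  where
  miss′ : ∀ i → y ≢ h i
  miss′ i e = miss (i , sym e)
  punchOut-injective′ : Injective _≡_ _≡_ (λ i → punchOut (miss′ i))
  punchOut-injective′ {i} {j} e = h-inj (punchOut-injective (miss′ i) (miss′ j) e)

injective⇒surjective : ∀ {N f} → InjectiveOn N f → MapsBelow N f → SurjectiveOn N f
injective⇒surjective {N} {f} inj maps {v} v<N =
  preimage (injective⇒surjective-Fin h h-injective (fromℕ< v<N))
  where
  h : Fin N → Fin N
  h i = fromℕ< (maps (toℕ<n i))
  h-injective : Injective _≡_ _≡_ h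
  h-injective {i} {j} e = toℕ-injective (inj (toℕ<n i) (toℕ<n j)
    (trans (sym (toℕ-fromℕ< _)) (trans (cong toℕ e) (toℕ-fromℕ< _))))
  preimage : ∃[ i ] h i ≡ fromℕ< v<N → ∃[ x ] x < N × f x ≡ v
  preimage (i , hi≡v) =
    toℕ i , toℕ<n i , trans (sym (toℕ-fromℕ< _)) (trans (cong toℕ hi≡v) (toℕ-fromℕ< v<N))

-- At the first position where f and g differ, say f x < g x, the value f x must occur in g
-- after x, below the smaller entry g x.
private
  noFirstDifference : ∀ {N a f g} → InjectiveOn N f → SurjectiveOn N g → IncreasingBelow N a g →
                      ∀ {x} → x < N → (∀ {y} → y < x → f y ≡ g y) →
                      f x < g x → g x < a → g x < N → ⊥
  noFirstDifference {a = a} {g = g} f-inj g-sur g-inc {x} x<N prefix fx<gx gx<a gx<N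
    with g-sur (<-trans fx<gx gx<N)
  ... | y , y<N , gy≡fx with <-cmp y x
  ... | tri< y<x _ _ = <-irrefl (f-inj y<N x<N (trans (prefix y<x) gy≡fx)) y<x
  ... | tri≈ _ refl _ = <-irrefl (sym gy≡fx) fx<gx
  ... | tri> _ _ x<y =
    <-asym fx<gx (subst (g x <_) gy≡fx (g-inc x<y y<N gx<a (subst (_< a) (sym gy≡fx) (<-trans fx<gx gx<a))))

determinedByLargeValues : ∀ {N a f g} →
  InjectiveOn N f → MapsBelow N f → IncreasingBelow N a f →
  InjectiveOn N g → MapsBelow N g → IncreasingBelow N a g →
  (∀ {v} → a ≤ v → v < N → ∃[ p ] p < N × f p ≡ v × g p ≡ v) → f ≗[ N ] g
determinedByLargeValues {N} {a} {f} {g} f-inj f-maps f-inc g-inj g-maps g-inc sameLarge {x} =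
  <-rec (λ x → x < N → f x ≡ g x) agree x
  where
  agreeˡ : ∀ {x} → x < N → a ≤ f x → f x ≡ g x
  agreeˡ x<N a≤fx with sameLarge a≤fx (f-maps x<N)
  ... | p , p<N , fp≡fx , gp≡fx with f-inj x<N p<N (sym fp≡fx)
  ...   | refl = sym gp≡fx
  agreeʳ : ∀ {x} → x < N → a ≤ g x → f x ≡ g x
  agreeʳ x<N a≤gx with sameLarge a≤gx (g-maps x<N)
  ... | p , p<N , fp≡gx , gp≡gx with g-inj x<N p<N (sym gp≡gx)
  ...   | refl = fp≡gx
  agree : ∀ x → (∀ {y} → y < x → y < N → f y ≡ g y) → x < N → f x ≡ g x
  agree x earlier x<N with <-cmp (f x) (g x)
  ... | tri≈ _ fx≡gx _ = fx≡gx
  ... | tri< fx<gx _ _ = ⊥-elim (noFirstDifference f-inj (injective⇒surjective g-inj g-maps) g-inc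
          x<N (λ y<x → earlier y<x (<-trans y<x x<N)) fx<gx
          (≰⇒> (λ a≤gx → <⇒≢ fx<gx (agreeʳ x<N a≤gx))) (g-maps x<N))
  ... | tri> _ _ gx<fx = ⊥-elim (noFirstDifference g-inj (injective⇒surjective f-inj f-maps) f-inc
          x<N (λ y<x → sym (earlier y<x (<-trans y<x x<N))) gx<fx
          (≰⇒> (λ a≤fx → <⇒≢ gx<fx (sym (agreeˡ x<N a≤fx)))) (f-maps x<N))

large⇒1<position : ∀ (f : ℕ → ℕ) {x} → f 1 ≡ 0 → f 0 < f x → 1 < x
large⇒1<position f {zero}        _    a<fx = ⊥-elim (<-irrefl refl a<fx)
large⇒1<position f {suc zero}    f1≡0 a<fx = ⊥-elim (n≮0 (subst (f 0 <_) f1≡0 a<fx))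
large⇒1<position f {suc (suc _)} _    _    = s≤s (s≤s z≤n)

offsetBy2 : ∀ {K x} → 1 < x → x < suc (suc K) → Σ (Fin K) λ q → x ≡ suc (suc (toℕ q))
offsetBy2 {x = suc (suc y)} (s≤s (s≤s _)) (s≤s (s≤s y<K)) =
  fromℕ< y<K , cong (suc ∘ suc) (sym (toℕ-fromℕ< y<K))

record Admissible (N : ℕ) (f : ℕ → ℕ) : Set where
  field
    injective       : InjectiveOn N f
    mapsBelow       : MapsBelow N f
    second≡0        : f 1 ≡ 0
    smallIncreasing : IncreasingBelow N (f 0) f
    largeNonMaxLast : ∀ {x} → x < N → f 0 < f x → suc (f x) < N → x ≡ pred N

module AdmissibleProperties {N f} (adm : Admissible N f) where
  open Admissible adm

  surjective : SurjectiveOn N f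
  surjective = injective⇒surjective injective mapsBelow

  largeNotLast⇒maximal : ∀ {x y} → x < y → y < N → f 0 < f x → N ≤ suc (f x)
  largeNotLast⇒maximal {x} x<y y<N a<fx with suc (f x) <? N
  ... | yes fx+1<N = contradiction (largeNonMaxLast (<-trans x<y y<N) a<fx fx+1<N)
                                   (<⇒≢ (<-≤-trans x<y (<⇒≤pred y<N)))
  ... | no  fx+1≮N = ≮⇒≥ fx+1≮N

  largeDecreasing : ∀ {x y} → x < y → y < N → f 0 < f x → f 0 < f y → f y < f x
  largeDecreasing x<y y<N a<fx _ =
    ≤∧≢⇒< (≤-pred (≤-trans (mapsBelow y<N) (largeNotLast⇒maximal x<y y<N a<fx)))
          (λ e → <⇒≢ x<y (sym (injective y<N (<-trans x<y y<N) e)))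

  no321WithLargeMiddle : ∀ {x y z} → x < y → y < z → z < N → f 0 < f y → f y < f x → ⊥
  no321WithLargeMiddle x<y y<z z<N a<fy fy<fx =
    <⇒≱ (mapsBelow (<-trans x<y (<-trans y<z z<N))) (≤-trans (largeNotLast⇒maximal y<z z<N a<fy) fy<fx)

  first-unique : ∀ {x} → x < N → f x ≡ f 0 → x ≡ 0
  first-unique x<N e = injective x<N (≤-<-trans z≤n x<N) e

  avoids321 : ∀ {x y z} → x < y → y < z → z < N → f y < f x → f z < f y → ⊥
  avoids321 {y = y} x<y y<z z<N fy<fx fz<fy with <-cmp (f y) (f 0)
  ... | tri< small _ _ = <-asym fz<fy (smallIncreasing y<z z<N small (<-trans fz<fy small))
  ... | tri≈ _ first _ = m<n⇒n≢0 x<y (first-unique (<-trans y<z z<N) first)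
  ... | tri> _ _ large = no321WithLargeMiddle x<y y<z z<N large fy<fx

  avoids2134 : ∀ {x y z w} → x < y → y < z → z < w → w < N →
               f y < f x → f x < f z → f z < f w → ⊥
  avoids2134 {z = z} x<y y<z z<w w<N fy<fx fx<fz fz<fw with <-cmp (f z) (f 0)
  ... | tri< small _ _ = <-asym fy<fx
          (smallIncreasing x<y (<-trans y<z (<-trans z<w w<N)) (<-trans fx<fz small)
            (<-trans fy<fx (<-trans fx<fz small)))
  ... | tri≈ _ first _ = m<n⇒n≢0 (≤-<-trans z≤n y<z) (first-unique (<-trans z<w w<N) first)
  ... | tri> _ _ large = <-asym fz<fw (largeDecreasing z<w w<N large (<-trans large fz<fw))

  avoidsVincular231 : ∀ {x y} → suc x < N → x < y → y < N → f y < f x → f x < f (suc x) → ⊥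
  avoidsVincular231 {x} sx<N x<y y<N fy<fx fx<fsx with <-cmp (f x) (f 0)
  ... | tri< small _ _ = <-asym fy<fx (smallIncreasing x<y y<N small (<-trans fy<fx small))
  ... | tri≈ _ first _ with first-unique (<-trans (n<1+n x) sx<N) first
  ...   | refl = n≮0 (subst (f 0 <_) second≡0 fx<fsx)
  avoidsVincular231 sx<N x<y y<N fy<fx fx<fsx | tri> _ _ large =
    <-asym fx<fsx (largeDecreasing (n<1+n _) sx<N large (<-trans large fx<fsx))

-- A word read as a function on ℕ; positions past the end read as 0.
entry : ∀ {n m} → Vec (Fin n) m → ℕ → ℕ
entry []       _       = 0
entry (v ∷ vs) zero    = toℕ v
entry (v ∷ vs) (suc x) = entry vs x

toℕ-lookup : ∀ {n m} (π : Vec (Fin n) m) i → toℕ (lookup π i) ≡ entry π (toℕ i)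
toℕ-lookup (v ∷ vs) Fin.zero    = refl
toℕ-lookup (v ∷ vs) (Fin.suc i) = toℕ-lookup vs i

entry-fromℕ< : ∀ {n} (π : Word n) {x} (x<n : x < n) → toℕ (lookup π (fromℕ< x<n)) ≡ entry π x
entry-fromℕ< π x<n = trans (toℕ-lookup π _) (cong (entry π) (toℕ-fromℕ< x<n))

wordOf : ∀ {N} (f : ℕ → ℕ) → MapsBelow N f → Word N
wordOf f maps = tabulate (λ i → fromℕ< (maps (toℕ<n i)))

toℕ-lookup-wordOf : ∀ {N} f (maps : MapsBelow N f) i → toℕ (lookup (wordOf f maps) i) ≡ f (toℕ i)
toℕ-lookup-wordOf f maps i = trans (cong toℕ (lookup∘tabulate _ i)) (toℕ-fromℕ< _)

wordOf-unique : ∀ {N f} (maps : MapsBelow N f) (π : Word N) → entry π ≗[ N ] f → π ≡ wordOf f maps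
wordOf-unique maps π agree = trans (sym (tabulate∘lookup π)) (tabulate-cong λ i →
  toℕ-injective (trans (toℕ-lookup π i) (trans (agree (toℕ<n i)) (sym (toℕ-fromℕ< _)))))

wordOf-injective : ∀ {N f g} (f-maps : MapsBelow N f) (g-maps : MapsBelow N g) →
                   wordOf f f-maps ≡ wordOf g g-maps → f ≗[ N ] g
wordOf-injective {f = f} {g} f-maps g-maps eq {x} x<N = begin
  f x                                    ≡⟨ cong f (toℕ-fromℕ< x<N) ⟨
  f (toℕ i)                              ≡⟨ toℕ-lookup-wordOf f f-maps i ⟨
  toℕ (lookup (wordOf f f-maps) i)       ≡⟨ cong (λ w → toℕ (lookup w i)) eq ⟩
  toℕ (lookup (wordOf g g-maps) i)       ≡⟨ toℕ-lookup-wordOf g g-maps i ⟩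
  g (toℕ i)                              ≡⟨ cong g (toℕ-fromℕ< x<N) ⟩
  g x                                    ∎
  where
  open ≡-Reasoning
  i = fromℕ< x<N

wordOfAdmissible : ∀ {N f} → Admissible N f → Word N
wordOfAdmissible adm = wordOf _ (Admissible.mapsBelow adm)

admissible⇒counted : ∀ {N f} (adm : Admissible N f) → 1 < N → Counted (wordOfAdmissible adm)
admissible⇒counted {N} {f} adm 1<N =
  isPerm , isFishburn , no321 , no2134 ,
  (fromℕ< 1<N , toℕ-fromℕ< 1<N , trans (value _) (trans (cong f (toℕ-fromℕ< 1<N)) second≡0))
  where
  open Admissible adm
  open AdmissibleProperties adm
  π = wordOf f mapsBelow
  value : ∀ i → toℕ (lookup π i) ≡ f (toℕ i)
  value = toℕ-lookup-wordOf f mapsBelow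
  value< : ∀ {i j} → lookup π i ≺ lookup π j → f (toℕ i) < f (toℕ j)
  value< {i} {j} = subst₂ _<_ (value i) (value j)
  isPerm : IsPerm π
  isPerm i j e = toℕ-injective (injective (toℕ<n i) (toℕ<n j)
    (trans (sym (value i)) (trans (cong toℕ e) (value j))))
  isFishburn : IsFishburn π
  isFishburn (i , i′ , j , i′≡1+i , i<j , πj<πi , πi<πi′ , _) =
    avoidsVincular231 (subst (_< N) i′≡1+i (toℕ<n i′)) i<j (toℕ<n j) (value< πj<πi)
      (subst (λ k → f (toℕ i) < f k) i′≡1+i (value< πi<πi′))
  no321 : ¬ Contains321 π
  no321 (_ , _ , k , i<j , j<k , πj<πi , πk<πj) =
    avoids321 i<j j<k (toℕ<n k) (value< πj<πi) (value< πk<πj)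
  no2134 : ¬ Contains2134 π
  no2134 (_ , _ , _ , l , i<j , j<k , k<l , πj<πi , πi<πk , πk<πl) =
    avoids2134 i<j j<k k<l (toℕ<n l) (value< πj<πi) (value< πi<πk) (value< πk<πl)

module _ {n} (π : Word n) where
  private
    pos< : ∀ {x y} (x<n : x < n) (y<n : y < n) → x < y → toℕ (fromℕ< x<n) < toℕ (fromℕ< y<n)
    pos< x<n y<n = subst₂ _<_ (sym (toℕ-fromℕ< x<n)) (sym (toℕ-fromℕ< y<n))
    val< : ∀ {x y} (x<n : x < n) (y<n : y < n) → entry π x < entry π y →
           lookup π (fromℕ< x<n) ≺ lookup π (fromℕ< y<n)
    val< x<n y<n = subst₂ _<_ (sym (entry-fromℕ< π x<n)) (sym (entry-fromℕ< π y<n))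

  contains321 : ∀ {x y z} → x < y → y < z → z < n →
                entry π y < entry π x → entry π z < entry π y → Contains321 π
  contains321 x<y y<z z<n fy<fx fz<fy =
    fromℕ< x<n , fromℕ< y<n , fromℕ< z<n , pos< x<n y<n x<y , pos< y<n z<n y<z ,
    val< y<n x<n fy<fx , val< z<n y<n fz<fy
    where
    y<n = <-trans y<z z<n
    x<n = <-trans x<y y<n

  contains2134 : ∀ {x y z w} → x < y → y < z → z < w → w < n →
                 entry π y < entry π x → entry π x < entry π z → entry π z < entry π w → Contains2134 π
  contains2134 x<y y<z z<w w<n fy<fx fx<fz fz<fw =
    fromℕ< x<n , fromℕ< y<n , fromℕ< z<n , fromℕ< w<n ,
    pos< x<n y<n x<y , pos< y<n z<n y<z , pos< z<n w<n z<w ,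
    val< y<n x<n fy<fx , val< x<n z<n fx<fz , val< z<n w<n fz<fw
    where
    z<n = <-trans z<w w<n
    y<n = <-trans y<z z<n
    x<n = <-trans x<y y<n

module CountedProperties {n} {π : Word n} (isPerm : IsPerm π) (¬321 : ¬ Contains321 π)
  (¬2134 : ¬ Contains2134 π) (1<n : 1 < n) (second≡0 : entry π 1 ≡ 0) where
  private
    f = entry π

  injective : InjectiveOn n f
  injective x<n y<n e = begin
    _                    ≡⟨ toℕ-fromℕ< x<n ⟨
    toℕ (fromℕ< x<n)     ≡⟨ cong toℕ (isPerm _ _ (toℕ-injective
                              (trans (entry-fromℕ< π x<n) (trans e (sym (entry-fromℕ< π y<n)))))) ⟩
    toℕ (fromℕ< y<n)     ≡⟨ toℕ-fromℕ< y<n ⟩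
    _                    ∎
    where open ≡-Reasoning

  mapsBelow : MapsBelow n f
  mapsBelow x<n = subst (_< n) (entry-fromℕ< π x<n) (toℕ<n _)

  smallIncreasing : IncreasingBelow n (f 0) f
  smallIncreasing {x} {y} x<y y<n fx<a _ with <-cmp (f x) (f y)
  ... | tri< fx<fy _ _ = fx<fy
  ... | tri≈ _ fx≡fy _ = contradiction (injective (<-trans x<y y<n) y<n fx≡fy) (<⇒≢ x<y)
  ... | tri> _ _ fy<fx = ⊥-elim (¬321 (contains321 π 0<x x<y y<n fx<a fy<fx))
    where
    0<x : 0 < x
    0<x = n≢0⇒n>0 λ { refl → <-irrefl refl fx<a }

  private
    0<first : 0 < f 0
    0<first = n≢0⇒n>0 λ f0≡0 → 1+n≢0 (injective 1<n (<-trans z<s 1<n) (trans second≡0 (sym f0≡0)))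

    -- Any increasing pair of large entries would complete 2134 with the first two entries.
    largeDecreasing : ∀ {x y} → x < y → y < n → f 0 < f x → f 0 < f y → f y < f x
    largeDecreasing {x} {y} x<y y<n a<fx _ with <-cmp (f x) (f y)
    ... | tri< fx<fy _ _ = ⊥-elim (¬2134 (contains2134 π z<s (large⇒1<position f second≡0 a<fx) x<y y<n
                                     (subst (_< f 0) (sym second≡0) 0<first) a<fx fx<fy))
    ... | tri≈ _ fx≡fy _ = contradiction (injective (<-trans x<y y<n) y<n fx≡fy) (<⇒≢ x<y)
    ... | tri> _ _ fy<fx = fy<fx

    -- The next larger value sits before r, so an entry after r would complete 321 or 2134.
    notFollowed : ∀ {r} → suc r < n → f 0 < f r → suc (f r) < n → ⊥
    notFollowed {r} r+1<n a<fr fr+1<n with injective⇒surjective injective mapsBelow fr+1<n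
    ... | s , s<n , fs≡fr+1 with <-cmp s r | <-cmp (f (suc r)) (f r)
    ... | tri< s<r _ _ | tri< next<fr _ _ =
      ¬321 (contains321 π s<r (n<1+n r) r+1<n (subst (f r <_) (sym fs≡fr+1) (n<1+n _)) next<fr)
    ... | tri< _ _ _   | tri≈ _ next≡fr _ = 1+n≢n (injective r+1<n (<-trans (n<1+n r) r+1<n) next≡fr)
    ... | tri< _ _ _   | tri> _ _ fr<next =
      <-asym fr<next (largeDecreasing (n<1+n r) r+1<n a<fr (<-trans a<fr fr<next))
    ... | tri≈ _ refl _ | _ = 1+n≢n (sym fs≡fr+1)
    ... | tri> _ _ r<s | _ =
      <-asym (subst (f r <_) (sym fs≡fr+1) (n<1+n _))
             (largeDecreasing r<s s<n a<fr (subst (f 0 <_) (sym fs≡fr+1) (<-trans a<fr (n<1+n _))))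

  largeNonMaxLast : ∀ {x} → x < n → f 0 < f x → suc (f x) < n → x ≡ pred n
  largeNonMaxLast {x} x<n a<fx fx+1<n with suc x <? n
  ... | yes x+1<n = ⊥-elim (notFollowed x+1<n a<fx fx+1<n)
  ... | no  x+1≮n = ≤-antisym (<⇒≤pred x<n) (pred-mono-≤ (≮⇒≥ x+1≮n))

counted⇒admissible : ∀ {n} {π : Word n} → Counted π → Admissible n (entry π)
counted⇒admissible {n} {π} (isPerm , _ , ¬321 , ¬2134 , (p , p≡1 , πp≡0)) =
  record { CountedProperties {π = π} isPerm ¬321 ¬2134 1<n second≡0 ; second≡0 = second≡0 }
  where
  1<n : 1 < n
  1<n = subst (_< n) p≡1 (toℕ<n p)
  second≡0 : entry π 1 ≡ 0
  second≡0 = trans (cong (entry π) (sym p≡1)) (trans (sym (toℕ-lookup π p)) πp≡0)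

infixr 5 _◂_

_◂_ : ℕ → (ℕ → ℕ) → ℕ → ℕ
(c ◂ h) zero    = c
(c ◂ h) (suc x) = h x

insertAt : ℕ → ℕ → (ℕ → ℕ) → ℕ → ℕ
insertAt zero    v h = v ◂ h
insertAt (suc p) v h = h 0 ◂ insertAt p v (h ∘ suc)

insertAt-at : ∀ p v h → insertAt p v h p ≡ v
insertAt-at zero    v h = refl
insertAt-at (suc p) v h = insertAt-at p v (h ∘ suc)

insertAt-below : ∀ {p x} v h → x < p → insertAt p v h x ≡ h x
insertAt-below {suc p} {zero}  v h _         = refl
insertAt-below {suc p} {suc x} v h (s≤s x<p) = insertAt-below v (h ∘ suc) x<p

insertAt-above : ∀ {p x} v h → p ≤ x → insertAt p v h (suc x) ≡ h x
insertAt-above {zero}          v h _         = refl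
insertAt-above {suc p} {suc x} v h (s≤s p≤x) = insertAt-above v (h ∘ suc) p≤x

insertAt-preserves : ∀ (P : ℕ → Set) {p L v h} → p ≤ L → P v → (∀ {z} → z < L → P (h z)) →
                     ∀ {x} → x < suc L → P (insertAt p v h x)
insertAt-preserves P {zero}          _         Pv Ph {zero}  _         = Pv
insertAt-preserves P {zero}          _         Pv Ph {suc x} (s≤s x<L) = Ph x<L
insertAt-preserves P {suc p} {suc L} (s≤s p≤L) Pv Ph {zero}  _         = Ph z<s
insertAt-preserves P {suc p} {suc L} (s≤s p≤L) Pv Ph {suc x} (s≤s x<L) =
  insertAt-preserves P p≤L Pv (Ph ∘ s≤s) x<L

◂-mapsBelow : ∀ {L c h} → c < suc L → (∀ {z} → z < L → h z < suc L) → MapsBelow (suc L) (c ◂ h)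
◂-mapsBelow c<N h<N {zero}  _         = c<N
◂-mapsBelow c<N h<N {suc x} (s≤s x<L) = h<N x<L

◂-injective : ∀ {L c h} → InjectiveOn L h → (∀ {z} → z < L → h z ≢ c) → InjectiveOn (suc L) (c ◂ h)
◂-injective inj avoid {zero}  {zero}  _         _         _ = refl
◂-injective inj avoid {zero}  {suc y} _         (s≤s y<L) e = contradiction (sym e) (avoid y<L)
◂-injective inj avoid {suc x} {zero}  (s≤s x<L) _         e = contradiction e (avoid x<L)
◂-injective inj avoid {suc x} {suc y} (s≤s x<L) (s≤s y<L) e = cong suc (inj x<L y<L e)

insertAt-injective : ∀ {p L v h} → p ≤ L → InjectiveOn L h → (∀ {z} → z < L → h z ≢ v) →
                     InjectiveOn (suc L) (insertAt p v h)
insertAt-injective {zero}                  _         inj avoid = ◂-injective inj avoid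
insertAt-injective {suc p} {suc L} {h = h} (s≤s p≤L) inj avoid =
  ◂-injective (insertAt-injective p≤L (λ x<L y<L e → suc-injective (inj (s≤s x<L) (s≤s y<L) e))
                                     (avoid ∘ s≤s))
              (insertAt-preserves (_≢ h 0) p≤L (≢-sym (avoid z<s)) λ z<L e → 1+n≢0 (inj (s≤s z<L) z<s e))

◂-increasing : ∀ {L a c h} → IncreasingBelow L a h → (c < a → ∀ {z} → z < L → h z < a → c < h z) →
               IncreasingBelow (suc L) a (c ◂ h)
◂-increasing inc head {zero}  {suc y} _         (s≤s y<L) c<a hy<a = head c<a y<L hy<a
◂-increasing inc head {suc x} {suc y} (s≤s x<y) (s≤s y<L)          = inc x<y y<L

◂-increasing-top : ∀ {L a h} → IncreasingBelow L a h → IncreasingBelow (suc L) a (a ◂ h)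
◂-increasing-top inc = ◂-increasing inc (λ a<a → ⊥-elim (<-irrefl refl a<a))

insertAt-increasing : ∀ {p L a v h} → p ≤ L → a ≤ v → IncreasingBelow L a h →
                      IncreasingBelow (suc L) a (insertAt p v h)
insertAt-increasing {zero} _ a≤v inc = ◂-increasing inc (λ v<a → contradiction a≤v (<⇒≱ v<a))
insertAt-increasing {suc p} {suc L} {a} {h = h} (s≤s p≤L) a≤v inc =
  ◂-increasing (insertAt-increasing p≤L a≤v λ x<y y<L → inc (s≤s x<y) (s≤s y<L))
    λ h0<a → insertAt-preserves (λ w → w < a → h 0 < w) p≤L
               (λ v<a → contradiction a≤v (<⇒≱ v<a)) (λ z<L → inc z<s (s≤s z<L) h0<a)

id-injective : ∀ {L} → InjectiveOn L id
id-injective _ _ e = e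

id-increasing : ∀ {L a} → IncreasingBelow L a id
id-increasing x<y _ _ _ = x<y

noNonMaximalLarge : ∀ {N a v} → N ≤ suc (suc a) → a < v → suc v < N → ⊥
noNonMaximalLarge N≤a+2 a<v v+1<N = <-irrefl refl (≤-<-trans (s≤s a<v) (<-≤-trans v+1<N N≤a+2))

-- In one-line notation with values 1..n, where n = M + 3:
--   familyA M   = n 1 2 ⋯ (n-1)
--   familyB M q = (n-1) 1 ⋯ (q+1) n (q+2) ⋯ (n-2)
--   familyC M q = (n-2) 1 ⋯ (q+1) n (q+2) ⋯ (n-3) (n-1)
familyA : ℕ → ℕ → ℕ
familyA M = suc (suc M) ◂ id

familyB : (M : ℕ) → Fin (suc M) → ℕ → ℕ
familyB M q = suc M ◂ insertAt (suc (toℕ q)) (suc (suc M)) id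

familyC : (M : ℕ) → Fin M → ℕ → ℕ
familyC M q = M ◂ insertAt (suc (toℕ q)) (suc (suc M)) (insertAt M (suc M) id)

familyB-max : ∀ M q → familyB M q (suc (suc (toℕ q))) ≡ suc (suc M)
familyB-max M q = insertAt-at (suc (toℕ q)) _ id

familyC-max : ∀ M q → familyC M q (suc (suc (toℕ q))) ≡ suc (suc M)
familyC-max M q = insertAt-at (suc (toℕ q)) _ (insertAt M (suc M) id)

familyC-last : ∀ M q → familyC M q (suc (suc M)) ≡ suc M
familyC-last M q = trans (insertAt-above _ (insertAt M (suc M) id) (toℕ<n q)) (insertAt-at M (suc M) id)

familyA-admissible : ∀ M → Admissible (3 + M) (familyA M)
familyA-admissible M = record
  { injective       = ◂-injective id-injective <⇒≢
  ; mapsBelow       = ◂-mapsBelow (n<1+n _) m<n⇒m<1+n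
  ; second≡0        = refl
  ; smallIncreasing = ◂-increasing-top id-increasing
  ; largeNonMaxLast = λ _ a<fx fx+1<N → ⊥-elim (noNonMaximalLarge (n≤1+n _) a<fx fx+1<N)
  }

familyB-admissible : ∀ M q → Admissible (3 + M) (familyB M q)
familyB-admissible M q = record
  { injective       = ◂-injective (insertAt-injective q+1≤M+1 id-injective (<⇒≢ ∘ m<n⇒m<1+n))
                                  (insertAt-preserves (_≢ suc M) q+1≤M+1 1+n≢n <⇒≢)
  ; mapsBelow       = ◂-mapsBelow (m<n⇒m<1+n (n<1+n _))
                                  (insertAt-preserves (_< 3 + M) q+1≤M+1 (n<1+n _) (m<n⇒m<1+n ∘ m<n⇒m<1+n))
  ; second≡0        = refl
  ; smallIncreasing = ◂-increasing-top (insertAt-increasing q+1≤M+1 (n≤1+n _) id-increasing)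
  ; largeNonMaxLast = λ _ a<fx fx+1<N → ⊥-elim (noNonMaximalLarge ≤-refl a<fx fx+1<N)
  }
  where
  q+1≤M+1 : suc (toℕ q) ≤ suc M
  q+1≤M+1 = toℕ<n q

familyC-admissible : ∀ M q → Admissible (3 + M) (familyC M q)
familyC-admissible M q = record
  { injective       = injective
  ; mapsBelow       = ◂-mapsBelow (m<n⇒m<1+n (m<n⇒m<1+n (n<1+n _)))
                        (insertAt-preserves (_< 3 + M) q+1≤M+1 (n<1+n _)
                          (insertAt-preserves (_< 3 + M) ≤-refl (m<n⇒m<1+n (n<1+n _))
                            (m<n⇒m<1+n ∘ m<n⇒m<1+n ∘ m<n⇒m<1+n)))
  ; second≡0        = insertAt-below (suc M) id (≤-<-trans z≤n (toℕ<n q))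
  ; smallIncreasing = ◂-increasing-top (insertAt-increasing q+1≤M+1 (m≤n⇒m≤1+n (n≤1+n M))
                        (insertAt-increasing ≤-refl (n≤1+n M) id-increasing))
  ; largeNonMaxLast = largeNonMaxLast
  }
  where
  q+1≤M+1 : suc (toℕ q) ≤ suc M
  q+1≤M+1 = m≤n⇒m≤1+n (toℕ<n q)
  g = familyC M q
  injective : InjectiveOn (3 + M) g
  injective = ◂-injective
    (insertAt-injective q+1≤M+1 (insertAt-injective ≤-refl id-injective (<⇒≢ ∘ m<n⇒m<1+n))
      (insertAt-preserves (_≢ suc (suc M)) ≤-refl (1+n≢n ∘ sym) (<⇒≢ ∘ m<n⇒m<1+n ∘ m<n⇒m<1+n)))
    (insertAt-preserves (_≢ M) q+1≤M+1 (≢-sym (<⇒≢ (m<n⇒m<1+n (n<1+n M))))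
      (insertAt-preserves (_≢ M) ≤-refl 1+n≢n <⇒≢))
  largeNonMaxLast : ∀ {x} → x < 3 + M → M < g x → suc (g x) < 3 + M → x ≡ suc (suc M)
  largeNonMaxLast x<N M<gx gx+1<N =
    injective x<N ≤-refl (trans (≤-antisym (≤-pred (≤-pred gx+1<N)) M<gx) (sym (familyC-last M q)))

module Classification {M f} (adm : Admissible (3 + M) f) where
  open Admissible adm
  open AdmissibleProperties adm using (surjective)

  agreesWithAdmissible : ∀ {g} → Admissible (3 + M) g → f 0 ≡ g 0 →
                         (∀ {v} → g 0 ≤ v → v < 3 + M → ∃[ p ] p < 3 + M × f p ≡ v × g p ≡ v) →
                         f ≗[ 3 + M ] g
  agreesWithAdmissible g-adm f0≡g0 = determinedByLargeValues
    injective mapsBelow (subst (λ a → IncreasingBelow (3 + M) a f) f0≡g0 smallIncreasing)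
    G.injective G.mapsBelow G.smallIncreasing
    where module G = Admissible g-adm

  valueAtLast : ∀ {v} → f 0 < v → suc v < 3 + M → f (suc (suc M)) ≡ v
  valueAtLast a<v v+1<N with surjective (<-trans (n<1+n _) v+1<N)
  ... | x , x<N , fx≡v with largeNonMaxLast x<N (subst (f 0 <_) (sym fx≡v) a<v)
                                              (subst (λ w → suc w < 3 + M) (sym fx≡v) v+1<N)
  ...   | refl = fx≡v

  -- Otherwise M and M+1 would both be large and non-maximal, hence both the last entry.
  M≤first : M ≤ f 0
  M≤first with M ≤? f 0
  ... | yes M≤a = M≤a
  ... | no  M≰a = ⊥-elim (1+n≢n (trans (sym (valueAtLast (<-trans a<M (n<1+n M)) ≤-refl))
                                        (valueAtLast a<M (m<n⇒m<1+n (n<1+n _)))))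
    where
    a<M : f 0 < M
    a<M = ≰⇒> M≰a

  agreesWithFamilyA : f 0 ≡ suc (suc M) → f ≗[ 3 + M ] familyA M
  agreesWithFamilyA a≡M+2 = agreesWithAdmissible (familyA-admissible M) a≡M+2 λ M+2≤v v<N →
    let v≡M+2 = ≤-antisym (≤-pred v<N) M+2≤v in 0 , z<s , trans a≡M+2 (sym v≡M+2) , sym v≡M+2

  agreesWithFamilyB : f 0 ≡ suc M → ∃[ q ] f ≗[ 3 + M ] familyB M q
  agreesWithFamilyB a≡M+1 with surjective (n<1+n (suc (suc M)))
  ... | p , p<N , fp≡M+2
    with offsetBy2 (large⇒1<position f second≡0 (subst₂ _<_ (sym a≡M+1) (sym fp≡M+2) (n<1+n _))) p<N
  ... | q , refl = q , agreesWithAdmissible (familyB-admissible M q) a≡M+1 large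
    where
    large : ∀ {v} → suc M ≤ v → v < 3 + M → ∃[ p ] p < 3 + M × f p ≡ v × familyB M q p ≡ v
    large M+1≤v v<N with m≤n⇒m<n∨m≡n M+1≤v
    ... | inj₂ M+1≡v = 0 , z<s , trans a≡M+1 M+1≡v , M+1≡v
    ... | inj₁ M+1<v with ≤-antisym (≤-pred v<N) M+1<v
    ...   | refl = _ , p<N , fp≡M+2 , familyB-max M q

  last≡M+1 : f 0 ≡ M → f (suc (suc M)) ≡ suc M
  last≡M+1 a≡M = valueAtLast (subst (_< suc M) (sym a≡M) (n<1+n M)) ≤-refl

  agreesWithFamilyC : f 0 ≡ M → ∃[ q ] f ≗[ 3 + M ] familyC M q
  agreesWithFamilyC a≡M with surjective (n<1+n (suc (suc M)))
  ... | p , p<N , fp≡M+2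
    with offsetBy2 (large⇒1<position f second≡0 (subst₂ _<_ (sym a≡M) (sym fp≡M+2) (m<n⇒m<1+n (n<1+n _))))
                   (≤∧≢⇒< (≤-pred p<N) p≢last)
    where
    p≢last : p ≢ suc (suc M)
    p≢last refl = 1+n≢n (trans (sym fp≡M+2) (last≡M+1 a≡M))
  ... | q , refl = q , agreesWithAdmissible (familyC-admissible M q) a≡M large
    where
    large : ∀ {v} → M ≤ v → v < 3 + M → ∃[ p ] p < 3 + M × f p ≡ v × familyC M q p ≡ v
    large M≤v v<N with m≤n⇒m<n∨m≡n M≤v
    ... | inj₂ M≡v = 0 , z<s , trans a≡M M≡v , M≡v
    ... | inj₁ M<v with m≤n⇒m<n∨m≡n M<v
    ...   | inj₂ refl = _ , ≤-refl , last≡M+1 a≡M , familyC-last M q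
    ...   | inj₁ M+1<v with ≤-antisym (≤-pred v<N) M+1<v
    ...     | refl = _ , p<N , fp≡M+2 , familyC-max M q

  classify : f ≗[ 3 + M ] familyA M
           ⊎ (∃[ q ] f ≗[ 3 + M ] familyB M q)
           ⊎ (∃[ q ] f ≗[ 3 + M ] familyC M q)
  classify with m≤n⇒m<n∨m≡n M≤first
  ... | inj₂ M≡a = inj₂ (inj₂ (agreesWithFamilyC (sym M≡a)))
  ... | inj₁ M<a with m≤n⇒m<n∨m≡n M<a
  ...   | inj₂ M+1≡a = inj₂ (inj₁ (agreesWithFamilyB (sym M+1≡a)))
  ...   | inj₁ M+1<a = inj₁ (agreesWithFamilyA (≤-antisym (≤-pred (mapsBelow z<s)) M+1<a))

wordOfAdmissible-≢ : ∀ {N f g} (f-adm : Admissible (suc N) f) (g-adm : Admissible (suc N) g) →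
                     f 0 ≢ g 0 → wordOfAdmissible f-adm ≢ wordOfAdmissible g-adm
wordOfAdmissible-≢ f-adm g-adm f0≢g0 eq =
  f0≢g0 (wordOf-injective (Admissible.mapsBelow f-adm) (Admissible.mapsBelow g-adm) eq z<s)

wordOfAdmissible-injective : ∀ {N K v} {F : Fin K → ℕ → ℕ} (adm : ∀ q → Admissible N (F q)) →
                             (∀ q → suc (suc (toℕ q)) < N) → (∀ q → F q (suc (suc (toℕ q))) ≡ v) →
                             Injective _≡_ _≡_ (λ q → wordOfAdmissible (adm q))
wordOfAdmissible-injective {F = F} adm pos<N at-pos {i} {j} eq =
  toℕ-injective (suc-injective (suc-injective (Admissible.injective (adm j) (pos<N i) (pos<N j) (begin
    F j (suc (suc (toℕ i)))  ≡⟨ wordOf-injective (mapsBelow (adm i)) (mapsBelow (adm j)) eq (pos<N i) ⟨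
    F i (suc (suc (toℕ i)))  ≡⟨ at-pos i ⟩
    _                        ≡⟨ at-pos j ⟨
    F j (suc (suc (toℕ j)))  ∎))))
  where
  open ≡-Reasoning
  open Admissible using (mapsBelow)

module _ (M : ℕ) where
  open Admissible using (mapsBelow)

  wordA : Word (3 + M)
  wordA = wordOfAdmissible (familyA-admissible M)

  wordB : Fin (suc M) → Word (3 + M)
  wordB q = wordOfAdmissible (familyB-admissible M q)

  wordC : Fin M → Word (3 + M)
  wordC q = wordOfAdmissible (familyC-admissible M q)

  countedWords : List (Word (3 + M))
  countedWords = wordA List.∷ List.tabulate wordB ++ List.tabulate wordC

  countedWords-length : length countedWords ≡ 2 * (3 + M) ∸ 4
  countedWords-length = begin
    suc (length (List.tabulate wordB ++ List.tabulate wordC))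
      ≡⟨ cong suc (length-++ (List.tabulate wordB)) ⟩
    suc (length (List.tabulate wordB) + length (List.tabulate wordC))
      ≡⟨ cong suc (cong₂ _+_ (length-tabulate wordB) (length-tabulate wordC)) ⟩
    suc (suc M + M)
      ≡⟨ cong (λ k → suc (suc (M + k))) (+-identityʳ M) ⟨
    2 + 2 * M
      ≡⟨ cong (_∸ 4) (*-distribˡ-+ 2 3 M) ⟨
    2 * (3 + M) ∸ 4
      ∎
    where open ≡-Reasoning

  countedWords-unique : Unique countedWords
  countedWords-unique = All.tabulate wordA-fresh AllPairs.∷
    Unique.++⁺ (Unique.tabulate⁺ (wordOfAdmissible-injective (familyB-admissible M)
                                    (λ q → s≤s (s≤s (toℕ<n q))) (familyB-max M)))
               (Unique.tabulate⁺ (wordOfAdmissible-injective (familyC-admissible M)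
                                    (λ q → m<n⇒m<1+n (s≤s (s≤s (toℕ<n q)))) (familyC-max M)))
               disjoint
    where
    wordA-fresh : ∀ {w} → w ∈ List.tabulate wordB ++ List.tabulate wordC → wordA ≢ w
    wordA-fresh w∈ with ∈-++⁻ (List.tabulate wordB) w∈
    ... | inj₁ w∈B with ∈-tabulate⁻ {f = wordB} w∈B
    ...   | q , refl = wordOfAdmissible-≢ (familyA-admissible M) (familyB-admissible M q) 1+n≢n
    wordA-fresh w∈ | inj₂ w∈C with ∈-tabulate⁻ {f = wordC} w∈C
    ...   | q , refl = wordOfAdmissible-≢ (familyA-admissible M) (familyC-admissible M q)
                         (≢-sym (<⇒≢ (m<n⇒m<1+n (n<1+n M))))
    disjoint : ∀ {w} → ¬ (w ∈ List.tabulate wordB × w ∈ List.tabulate wordC)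
    disjoint (w∈B , w∈C) with ∈-tabulate⁻ {f = wordB} w∈B | ∈-tabulate⁻ {f = wordC} w∈C
    ... | q , refl | r , B≡C = wordOfAdmissible-≢ (familyB-admissible M q) (familyC-admissible M r) 1+n≢n B≡C

  countedWords-complete : ∀ π → (π ∈ countedWords) ⇔ Counted π
  countedWords-complete π = mk⇔ sound complete
    where
    sound : π ∈ countedWords → Counted π
    sound (here refl) = admissible⇒counted (familyA-admissible M) (s≤s (s≤s z≤n))
    sound (there π∈) with ∈-++⁻ (List.tabulate wordB) π∈
    ... | inj₁ π∈B with ∈-tabulate⁻ {f = wordB} π∈B
    ...   | q , refl = admissible⇒counted (familyB-admissible M q) (s≤s (s≤s z≤n))
    sound (there π∈) | inj₂ π∈C with ∈-tabulate⁻ {f = wordC} π∈C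
    ...   | q , refl = admissible⇒counted (familyC-admissible M q) (s≤s (s≤s z≤n))
    complete : Counted π → π ∈ countedWords
    complete c with Classification.classify (counted⇒admissible {π = π} c)
    ... | inj₁ π≗A = here (wordOf-unique (mapsBelow (familyA-admissible M)) π π≗A)
    ... | inj₂ (inj₁ (q , π≗B)) =
      there (∈-++⁺ˡ
        (subst (_∈ List.tabulate wordB) (sym (wordOf-unique (mapsBelow (familyB-admissible M q)) π π≗B))
               (∈-tabulate⁺ {f = wordB} q)))
    ... | inj₂ (inj₂ (q , π≗C)) =
      there (∈-++⁺ʳ (List.tabulate wordB)
        (subst (_∈ List.tabulate wordC) (sym (wordOf-unique (mapsBelow (familyC-admissible M q)) π π≗C))
               (∈-tabulate⁺ {f = wordC} q)))

proposition2p5 : (n : ℕ) → 3 ≤ n → HasCount {n} Counted (2 * n ∸ 4)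
proposition2p5 (suc (suc (suc M))) (s≤s (s≤s (s≤s _))) =
  countedWords M , countedWords-unique M , countedWords-length M , countedWords-complete M
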